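{- Let $n$ be such that $n^{1/3}$ is a positive integer and let $E=\{1,\dots,n^{1/3}\}^3\subset\mathbb{R}^3$. Then the number of tuples $(x_1,x_2,x_3,x_4)\in E^4$ with $\angle(x_1,x_2,x_3)=\angle(x_2,x_3,x_4)=\pi/2$ is $\lesssim n^3$.
   Context: $\angle(x,y,z)\in[0,\pi]$ denotes the angle at $y$ between $x-y$ and $z-y$ (for $x\ne y\ne z$). $X\lesssim Y$ means $X\le CY$ for all $n>N$ with constants $C,N$ independent of $n$. -}

module Defs where

open import Data.Nat using (ℕ; suc)
open import Data.Integer as ℤ using (ℤ; +_; _-_; _*_; _+_)
import Data.Integer.Properties as ℤP
open import Data.Product using (_×_; _,_)
open import Data.Product.Properties using (≡-dec)
open import Data.List using (List; map; concatMap; upTo; filter; length)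
open import Relation.Binary.PropositionalEquality using (_≡_; _≢_)
open import Relation.Nullary using (Dec; ¬_; _×-dec_; ¬?)
open import Relation.Binary using (DecidableEquality)

-- Points of ℤ³ (E ⊂ ℤ³ ⊂ ℝ³; all relevant quantities are integers).
Pt : Set
Pt = ℤ × ℤ × ℤ

_-ᵖ_ : Pt → Pt → Pt
(a , b , c) -ᵖ (d , e , f) = (a - d , b - e , c - f)

dot : Pt → Pt → ℤ
dot (a , b , c) (d , e , f) = a * d + b * e + c * f

_≟ᵖ_ : DecidableEquality Pt
_≟ᵖ_ = ≡-dec ℤP._≟_ (≡-dec ℤP._≟_ ℤP._≟_)

-- ∠(x,y,z) = π/2 : x ≠ y, z ≠ y, and cos∠ = (x-y)·(z-y)/(|x-y||z-y|) = 0,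
-- i.e. (x-y)·(z-y) = 0.
RightAngle : Pt → Pt → Pt → Set
RightAngle x y z = (x ≢ y) × (z ≢ y) × (dot (x -ᵖ y) (z -ᵖ y) ≡ 0ℤ)
  where 0ℤ = + 0

rightAngle? : ∀ x y z → Dec (RightAngle x y z)
rightAngle? x y z =
  ¬? (x ≟ᵖ y) ×-dec ¬? (z ≟ᵖ y) ×-dec (dot (x -ᵖ y) (z -ᵖ y) ℤP.≟ + 0)

range1 : ℕ → List ℤ
range1 m = map (λ k → + suc k) (upTo m)

E : ℕ → List Pt
E m = concatMap (λ a → concatMap (λ b → map (λ c → (a , b , c)) (range1 m)) (range1 m)) (range1 m)

Quad : Set
Quad = Pt × Pt × Pt × Pt

E⁴ : ℕ → List Quad
E⁴ m = concatMap (λ x₁ → concatMap (λ x₂ → concatMap (λ x₃ → map (λ x₄ → (x₁ , x₂ , x₃ , x₄))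
         (E m)) (E m)) (E m)) (E m)

Good : Quad → Set
Good (x₁ , x₂ , x₃ , x₄) = RightAngle x₁ x₂ x₃ × RightAngle x₂ x₃ x₄

good? : ∀ q → Dec (Good q)
good? (x₁ , x₂ , x₃ , x₄) = rightAngle? x₁ x₂ x₃ ×-dec rightAngle? x₂ x₃ x₄

count : ℕ → ℕ
count m = length (filter good? (E⁴ m))

{-# OPTIONS --safe #-}
module Submission where

-- Group the quadruples by the middle edge v = x₃ − x₂ ≠ 0: both x₁ − x₂ and
-- x₄ − x₃ lie in v^⊥ ∩ [−m, m]³, so count ≤ m³ Σ_{v ≠ 0} N(v)², where N(v)
-- counts the a ∈ [−m, m]³ with a · v = 0.  If h = v₃ has the largest absolute
-- value, then for fixed a₂ the solutions (a₁, a₃) of a₁v₁ + a₃h = −a₂v₂ are no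
-- more than the d ∈ [0, 2m] with h ∣ v₁d; hence N(v)² ≲ m² D(v₁,h) D(v₂,h).
-- Writing |h| = e f with e ∣ v₁ and f ∣ d gives Σ_{|c| ≤ |h|} D(c,h) ≲ m τ(h),
-- and Σ_{|h| ≤ m} τ(h)² ≲ m² by counting common multiples of two divisors.
-- Altogether count ≲ m³ · m² · m² · m² = m⁹ = n³.

open import Defs
open import Data.Nat as ℕ using (ℕ; zero; suc; z≤n; s≤s; _+_; _*_; _^_; _≤_; _<_; NonZero)
import Data.Nat.Properties as ℕP
open import Data.Nat.Tactic.RingSolver using (solve-∀)
open import Data.Integer as ℤ using (ℤ; +_)
import Data.Integer.Properties as ℤP
import Data.Integer.Tactic.RingSolver as ℤSolver
open import Algebra.Properties.AbelianGroup ℤP.+-0-abelianGroup using () renaming (∙-cancelˡ to +-cancelˡ-≡ᶻ)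
open import Data.Empty using (⊥-elim)
import Data.Nat.Divisibility as ℕ∣
open import Data.Nat.GCD using (gcd; GCD; gcd[m,n]∣m; gcd[m,n]∣n; gcd-GCD; GCD-*)
open import Data.Nat.Coprimality using (Coprime; GCD≡1⇒coprime; coprime-divisor)
import Data.Nat.Coprimality as Coprimality
open import Data.Integer.Divisibility.Signed using (_∣_; _∣?_; divides; ∣ᵤ⇒∣; ∣⇒∣ᵤ)
import Data.Integer.Divisibility.Signed as ℤ∣
import Data.Integer.DivMod as ℤDM
open import Data.List using (List; []; _∷_; _++_; map; concatMap; filter; length; applyUpTo)
open import Data.List.Membership.Propositional using (_∈_)
open import Data.List.Relation.Unary.Any using (here; there)
open import Data.Product using (Σ; _×_; _,_; proj₁; proj₂)
open import Data.Sum using (_⊎_; inj₁; inj₂)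
open import Function using (_∘_)
open import Relation.Binary.PropositionalEquality
open import Relation.Nullary using (Dec; yes; no; ¬_; ¬?)

𝟙 : {P : Set} → Dec P → ℕ
𝟙 (yes _) = 1
𝟙 (no _)  = 0

𝟙≤1 : {P : Set} (p : Dec P) → 𝟙 p ≤ 1
𝟙≤1 (yes _) = s≤s z≤n
𝟙≤1 (no _)  = z≤n

𝟙-mono : {P Q : Set} (p : Dec P) (q : Dec Q) → (P → Q) → 𝟙 p ≤ 𝟙 q
𝟙-mono (yes _) (yes _) _  = s≤s z≤n
𝟙-mono (yes x) (no ¬q) f  = ⊥-elim (¬q (f x))
𝟙-mono (no _)  _       _  = z≤n

𝟙-cong : {P Q : Set} (p : Dec P) (q : Dec Q) → (P → Q) → (Q → P) → 𝟙 p ≡ 𝟙 q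
𝟙-cong p q f g = ℕP.≤-antisym (𝟙-mono p q f) (𝟙-mono q p g)

𝟙-yes : {P : Set} (p : Dec P) → P → 𝟙 p ≡ 1
𝟙-yes (yes _) _ = refl
𝟙-yes (no ¬p) x = ⊥-elim (¬p x)

𝟙-no : {P : Set} (p : Dec P) → ¬ P → 𝟙 p ≡ 0
𝟙-no (yes x) ¬p = ⊥-elim (¬p x)
𝟙-no (no _)  _  = refl

∑ : {A : Set} → List A → (A → ℕ) → ℕ
∑ []       f = 0
∑ (x ∷ xs) f = f x + ∑ xs f

infix 5 ∑
syntax ∑ xs (λ x → e) = ∑[ x ∈ xs ] e

module _ {A : Set} where

  ∑-cong : ∀ xs {f g : A → ℕ} → (∀ x → f x ≡ g x) → ∑ xs f ≡ ∑ xs g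
  ∑-cong []       e = refl
  ∑-cong (x ∷ xs) e = cong₂ _+_ (e x) (∑-cong xs e)

  ∑-mono : ∀ xs {f g : A → ℕ} → (∀ {x} → x ∈ xs → f x ≤ g x) → ∑ xs f ≤ ∑ xs g
  ∑-mono []       le = z≤n
  ∑-mono (x ∷ xs) le = ℕP.+-mono-≤ (le (here refl)) (∑-mono xs (λ x∈ → le (there x∈)))

  ∑-monoᵖ : ∀ xs {f g : A → ℕ} → (∀ x → f x ≤ g x) → ∑ xs f ≤ ∑ xs g
  ∑-monoᵖ xs le = ∑-mono xs (λ {x} _ → le x)

  ∑-zero : ∀ xs (f : A → ℕ) → (∀ {x} → x ∈ xs → f x ≡ 0) → ∑ xs f ≡ 0
  ∑-zero []       f z = refl
  ∑-zero (x ∷ xs) f z rewrite z (here refl) = ∑-zero xs f (λ x∈ → z (there x∈))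

  ∑-++ : ∀ xs ys (f : A → ℕ) → ∑ (xs ++ ys) f ≡ ∑ xs f + ∑ ys f
  ∑-++ []       ys f = refl
  ∑-++ (x ∷ xs) ys f = trans (cong (_+_ (f x)) (∑-++ xs ys f)) (sym (ℕP.+-assoc (f x) _ _))

  ∑-+ : ∀ xs (f g : A → ℕ) → ∑[ x ∈ xs ] (f x + g x) ≡ ∑ xs f + ∑ xs g
  ∑-+ []       f g = refl
  ∑-+ (x ∷ xs) f g = trans (cong (_+_ (f x + g x)) (∑-+ xs f g)) (interchange (f x) (g x) _ _)
    where
    interchange : ∀ a b c d → (a + b) + (c + d) ≡ (a + c) + (b + d)
    interchange = solve-∀

  ∑-*ˡ : ∀ xs k (f : A → ℕ) → ∑[ x ∈ xs ] (k * f x) ≡ k * ∑ xs f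
  ∑-*ˡ []       k f = sym (ℕP.*-zeroʳ k)
  ∑-*ˡ (x ∷ xs) k f = trans (cong (_+_ (k * f x)) (∑-*ˡ xs k f)) (sym (ℕP.*-distribˡ-+ k (f x) _))

  ∑-*ʳ : ∀ xs k (f : A → ℕ) → ∑[ x ∈ xs ] (f x * k) ≡ ∑ xs f * k
  ∑-*ʳ xs k f = trans (∑-cong xs (λ x → ℕP.*-comm (f x) k)) (trans (∑-*ˡ xs k f) (ℕP.*-comm k _))

  ∑-const : ∀ (xs : List A) k → ∑[ _ ∈ xs ] k ≡ length xs * k
  ∑-const []       k = refl
  ∑-const (x ∷ xs) k = cong (_+_ k) (∑-const xs k)

  ∑-≥-term : ∀ xs (f : A → ℕ) {x} → x ∈ xs → f x ≤ ∑ xs f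
  ∑-≥-term (y ∷ xs) f (here refl) = ℕP.m≤m+n (f y) _
  ∑-≥-term (y ∷ xs) f (there x∈)  = ℕP.≤-trans (∑-≥-term xs f x∈) (ℕP.m≤n+m _ (f y))

  length-filter : {P : A → Set} (P? : ∀ x → Dec (P x)) → ∀ xs → length (filter P? xs) ≡ ∑[ x ∈ xs ] 𝟙 (P? x)
  length-filter P? []       = refl
  length-filter P? (x ∷ xs) with P? x
  ... | yes _ = cong suc (length-filter P? xs)
  ... | no _  = length-filter P? xs

module _ {A B : Set} where

  ∑-map : (g : A → B) → ∀ xs (f : B → ℕ) → ∑ (map g xs) f ≡ ∑[ x ∈ xs ] f (g x)
  ∑-map g []       f = refl
  ∑-map g (x ∷ xs) f = cong (_+_ (f (g x))) (∑-map g xs f)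

  ∑-concatMap : (g : A → List B) → ∀ xs (f : B → ℕ) → ∑ (concatMap g xs) f ≡ ∑[ x ∈ xs ] ∑ (g x) f
  ∑-concatMap g []       f = refl
  ∑-concatMap g (x ∷ xs) f = trans (∑-++ (g x) _ f) (cong (_+_ (∑ (g x) f)) (∑-concatMap g xs f))

  ∑-comm : ∀ xs ys (f : A → B → ℕ) → ∑[ x ∈ xs ] ∑[ y ∈ ys ] f x y ≡ ∑[ y ∈ ys ] ∑[ x ∈ xs ] f x y
  ∑-comm []       ys f = sym (trans (∑-const {B} ys 0) (ℕP.*-zeroʳ (length ys)))
  ∑-comm (x ∷ xs) ys f = trans (cong (_+_ (∑ ys (f x))) (∑-comm xs ys f))
                               (sym (∑-+ ys (f x) (λ y → ∑[ x′ ∈ xs ] f x′ y)))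

  ∑-*-∑ : ∀ xs ys (f : A → ℕ) (g : B → ℕ) → ∑ xs f * ∑ ys g ≡ ∑[ x ∈ xs ] ∑[ y ∈ ys ] (f x * g y)
  ∑-*-∑ xs ys f g = trans (sym (∑-*ʳ xs (∑ ys g) f)) (∑-cong xs (λ x → sym (∑-*ˡ ys (f x) g)))

interval : ℤ → ℕ → List ℤ
interval lo zero    = []
interval lo (suc n) = lo ∷ interval (lo ℤ.+ + 1) n

[lo+1]+k≡lo+[1+k] : ∀ lo k → (lo ℤ.+ + 1) ℤ.+ + k ≡ lo ℤ.+ + suc k
[lo+1]+k≡lo+[1+k] lo k = ℤP.+-assoc lo (+ 1) (+ k)

length-interval : ∀ lo n → length (interval lo n) ≡ n
length-interval lo zero    = refl
length-interval lo (suc n) = cong suc (length-interval _ n)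

interval-++ : ∀ lo a b → interval lo (a + b) ≡ interval lo a ++ interval (lo ℤ.+ + a) b
interval-++ lo zero    b = cong (λ z → interval z b) (sym (ℤP.+-identityʳ lo))
interval-++ lo (suc a) b = cong (lo ∷_) (trans (interval-++ (lo ℤ.+ + 1) a b)
                                               (cong (λ z → interval (lo ℤ.+ + 1) a ++ interval z b) ([lo+1]+k≡lo+[1+k] lo a)))

∈-interval⁻ : ∀ {x} lo n → x ∈ interval lo n → Σ ℕ λ k → k < n × x ≡ lo ℤ.+ + k
∈-interval⁻ lo (suc n) (here refl) = 0 , s≤s z≤n , sym (ℤP.+-identityʳ lo)
∈-interval⁻ lo (suc n) (there x∈) with ∈-interval⁻ (lo ℤ.+ + 1) n x∈
... | k , k<n , refl = suc k , s≤s k<n , [lo+1]+k≡lo+[1+k] lo k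

∈-interval⁺ : ∀ lo {n k} → k < n → lo ℤ.+ + k ∈ interval lo n
∈-interval⁺ lo {suc n} {zero}  _         = here (ℤP.+-identityʳ lo)
∈-interval⁺ lo {suc n} {suc k} (s≤s k<n) =
  there (subst (_∈ interval (lo ℤ.+ + 1) n) ([lo+1]+k≡lo+[1+k] lo k) (∈-interval⁺ (lo ℤ.+ + 1) k<n))

map-+-interval : ∀ q lo n → map (ℤ._+ q) (interval lo n) ≡ interval (lo ℤ.+ q) n
map-+-interval q lo zero    = refl
map-+-interval q lo (suc n) =
  cong (lo ℤ.+ q ∷_) (trans (map-+-interval q (lo ℤ.+ + 1) n) (cong (λ z → interval z n) (swap lo q)))
  where
  swap : ∀ a b → a ℤ.+ + 1 ℤ.+ b ≡ a ℤ.+ b ℤ.+ + 1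
  swap = ℤSolver.solve-∀

lo∉interval : ∀ {y} lo n → y ∈ interval (lo ℤ.+ + 1) n → y ≢ lo
lo∉interval lo n y∈ refl with ∈-interval⁻ (lo ℤ.+ + 1) n y∈
... | k , _ , eq with +-cancelˡ-≡ᶻ lo (+ suc k) (+ 0)
                        (trans (sym (trans eq ([lo+1]+k≡lo+[1+k] lo k))) (sym (ℤP.+-identityʳ lo)))
... | ()

∑-interval-shift : ∀ q lo n (f : ℤ → ℕ) → ∑ (interval (lo ℤ.+ q) n) f ≡ ∑[ x ∈ interval lo n ] f (x ℤ.+ q)
∑-interval-shift q lo n f = trans (cong (λ xs → ∑ xs f) (sym (map-+-interval q lo n))) (∑-map (ℤ._+ q) (interval lo n) f)

∑-interval-const : ∀ lo n k → ∑[ _ ∈ interval lo n ] k ≡ n * k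
∑-interval-const lo n k = trans (∑-const (interval lo n) k) (cong (_* k) (length-interval lo n))

∑-interval-mono : ∀ lo {n n′} (f : ℤ → ℕ) → n ≤ n′ → ∑ (interval lo n) f ≤ ∑ (interval lo n′) f
∑-interval-mono lo f z≤n       = z≤n
∑-interval-mono lo f (s≤s n≤n′) = ℕP.+-monoʳ-≤ (f lo) (∑-interval-mono (lo ℤ.+ + 1) f n≤n′)

∑-interval-suffix : ∀ lo i n (f : ℤ → ℕ) → ∑ (interval (lo ℤ.+ + i) n) f ≤ ∑ (interval lo (i + n)) f
∑-interval-suffix lo i n f = ℕP.≤-trans (ℕP.m≤n+m _ (∑ (interval lo i) f))
  (ℕP.≤-reflexive (sym (trans (cong (λ xs → ∑ xs f) (interval-++ lo i n)) (∑-++ (interval lo i) _ f))))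

∑-interval-atMostOne : {P : ℤ → Set} (P? : ∀ x → Dec (P x)) → (∀ {y y′} → P y → P y′ → y ≡ y′) →
                       ∀ lo n → ∑[ y ∈ interval lo n ] 𝟙 (P? y) ≤ 1
∑-interval-atMostOne P? unique lo zero    = z≤n
∑-interval-atMostOne P? unique lo (suc n) with P? lo
... | yes p = ℕP.≤-reflexive (cong suc (∑-zero (interval (lo ℤ.+ + 1) n) _
                (λ {y} y∈ → 𝟙-no (P? y) (λ py → lo∉interval lo n y∈ (unique py p)))))
... | no _  = ∑-interval-atMostOne P? unique (lo ℤ.+ + 1) n

multiples : ℤ → ℤ → ℕ → ℕ
multiples e lo n = ∑[ x ∈ interval lo n ] 𝟙 (e ∣? x)

∣-two-multiples-close : ∀ {e lo k} → + e ∣ lo → + e ∣ lo ℤ.+ + k → k < e → k ≡ 0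
∣-two-multiples-close {k = zero}  _ _ _ = refl
∣-two-multiples-close {k = suc k} e∣lo e∣lo+k k<e =
  ⊥-elim (ℕ∣.>⇒∤ k<e (∣⇒∣ᵤ (ℤ∣.∣m+n∣m⇒∣n e∣lo+k e∣lo)))

-- k < e is the gap from lo to the next multiple of e; tracking it lets the
-- induction consume the interval one element at a time.
*-multiples+gap≤ : ∀ e n lo k → k < e → + e ∣ lo ℤ.+ + k → e * multiples (+ e) lo n + k ≤ n + e
*-multiples+gap≤ e zero lo k k<e _ rewrite ℕP.*-zeroʳ e = ℕP.<⇒≤ k<e
*-multiples+gap≤ e (suc n) lo k k<e e∣lo+k with + e ∣? lo
... | yes e∣lo with ∣-two-multiples-close e∣lo e∣lo+k k<e
*-multiples+gap≤ (suc e₀) (suc n) lo .0 k<e e∣lo+k | yes e∣lo | refl = begin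
  e * (1 + M) + 0     ≡⟨ ℕP.+-identityʳ _ ⟩
  e * (1 + M)         ≡⟨ ℕP.*-distribˡ-+ e 1 M ⟩
  e * 1 + e * M       ≤⟨ ℕP.+-mono-≤ (ℕP.≤-reflexive (ℕP.*-identityʳ e)) e*M≤1+n ⟩
  e + suc n           ≡⟨ ℕP.+-comm e (suc n) ⟩
  suc n + e           ∎
  where
  open ℕP.≤-Reasoning
  e = suc e₀
  M = multiples (+ e) (lo ℤ.+ + 1) n
  e∣next : + e ∣ (lo ℤ.+ + 1) ℤ.+ + e₀
  e∣next = subst (+ e ∣_) (sym ([lo+1]+k≡lo+[1+k] lo e₀)) (ℤ∣.∣m∣n⇒∣m+n e∣lo ℤ∣.∣-refl)
  e*M≤1+n : e * M ≤ suc n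
  e*M≤1+n = ℕP.+-cancelʳ-≤ e₀ _ _ (ℕP.≤-trans (*-multiples+gap≤ e n (lo ℤ.+ + 1) e₀ ℕP.≤-refl e∣next)
                                               (ℕP.≤-reflexive (ℕP.+-suc n e₀)))
*-multiples+gap≤ e (suc n) lo zero k<e e∣lo+k | no e∤lo =
  ⊥-elim (e∤lo (subst (+ e ∣_) (ℤP.+-identityʳ lo) e∣lo+k))
*-multiples+gap≤ e (suc n) lo (suc k) k<e e∣lo+k | no e∤lo = begin
  e * multiples (+ e) (lo ℤ.+ + 1) n + suc k   ≡⟨ ℕP.+-suc _ k ⟩
  suc (e * multiples (+ e) (lo ℤ.+ + 1) n + k) ≤⟨ s≤s (*-multiples+gap≤ e n (lo ℤ.+ + 1) k (ℕP.<⇒≤ k<e)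
                                              (subst (+ e ∣_) (sym ([lo+1]+k≡lo+[1+k] lo k)) e∣lo+k)) ⟩
  suc n + e                                ∎
  where open ℕP.≤-Reasoning

*-multiples≤ : ∀ e .{{_ : NonZero e}} lo n → e * multiples (+ e) lo n ≤ n + e
*-multiples≤ e lo n = ℕP.≤-trans (ℕP.m≤m+n _ k) (*-multiples+gap≤ e n lo k (ℤDM.n%ℕd<d (ℤ.- lo) e) e∣lo+k)
  where
  k = (ℤ.- lo) ℤDM.%ℕ e
  q = (ℤ.- lo) ℤDM./ℕ e
  cancel : ∀ k x → ℤ.- (k ℤ.+ x) ℤ.+ k ≡ ℤ.- x
  cancel = ℤSolver.solve-∀
  lo+k≡-q*e : lo ℤ.+ + k ≡ ℤ.- (q ℤ.* + e)
  lo+k≡-q*e = begin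
    lo ℤ.+ + k                     ≡⟨ cong (ℤ._+ + k) (sym (ℤP.neg-involutive lo)) ⟩
    ℤ.- (ℤ.- lo) ℤ.+ + k           ≡⟨ cong (λ z → ℤ.- z ℤ.+ + k) (ℤDM.a≡a%ℕn+[a/ℕn]*n (ℤ.- lo) e) ⟩
    ℤ.- (+ k ℤ.+ q ℤ.* + e) ℤ.+ + k ≡⟨ cancel (+ k) (q ℤ.* + e) ⟩
    ℤ.- (q ℤ.* + e)                ∎
    where open ≡-Reasoning
  e∣lo+k : + e ∣ lo ℤ.+ + k
  e∣lo+k = subst (+ e ∣_) (sym lo+k≡-q*e) (ℤ∣.∣m⇒∣-m (ℤ∣.∣n⇒∣m*n q ℤ∣.∣-refl))

-- e = gcd C H, and f = H / e is coprime to C / e, hence divides D.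
∣*⇒∣-split : ∀ {H C D} → 0 < H → H ℕ∣.∣ C * D →
             Σ ℕ λ e → Σ ℕ λ f → e * f ≡ H × e ℕ∣.∣ C × f ℕ∣.∣ D
∣*⇒∣-split {H} {C} {D} 0<H H∣CD
  with gcd[m,n]∣m C H | gcd[m,n]∣n C H | gcd-GCD C H
... | ℕ∣.divides C′ C≡C′g | ℕ∣.divides f H≡fg | isGCD with gcd C H
...   | zero     = ⊥-elim (ℕP.<-irrefl refl (subst (0 <_) (trans H≡fg (ℕP.*-zeroʳ f)) 0<H))
...   | g@(suc _) =
  g , f , trans (ℕP.*-comm g f) (sym H≡fg) , ℕ∣.divides C′ C≡C′g , coprime-divisor f⊥C′ f∣C′D
  where
  f⊥C′ : Coprime f C′
  f⊥C′ = Coprimality.sym (GCD≡1⇒coprime (GCD-* (subst₂ (λ a b → GCD a b (1 * g)) C≡C′g H≡fg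
                                                (subst (GCD C H) (sym (ℕP.*-identityˡ g)) isGCD))))
  f∣C′D : f ℕ∣.∣ C′ * D
  f∣C′D = ℕ∣.*-cancelʳ-∣ g (subst₂ ℕ∣._∣_ H≡fg (trans (cong (_* D) C≡C′g) (swap C′ g D)) H∣CD)
    where
    swap : ∀ a b c → a * b * c ≡ a * c * b
    swap = solve-∀

-- The cubes {1, …, m}³ and [−m, m]³

I⁺ : ℕ → List ℤ
I⁺ m = interval (+ 1) m

I± : ℕ → List ℤ
I± m = interval (ℤ.- + m) (suc (m + m))

map-applyUpTo : {B : Set} (f : ℕ → B) (g : ℕ → ℕ) (n : ℕ) → map f (applyUpTo g n) ≡ applyUpTo (λ k → f (g k)) n
map-applyUpTo f g zero    = refl
map-applyUpTo f g (suc n) = cong (f (g 0) ∷_) (map-applyUpTo f (λ k → g (suc k)) n)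

applyUpTo-interval : ∀ (f : ℕ → ℤ) lo n → (∀ k → f k ≡ lo ℤ.+ + k) → applyUpTo f n ≡ interval lo n
applyUpTo-interval f lo zero    _  = refl
applyUpTo-interval f lo (suc n) eq = cong₂ _∷_ (trans (eq 0) (ℤP.+-identityʳ lo))
  (applyUpTo-interval (λ k → f (suc k)) (lo ℤ.+ + 1) n (λ k → trans (eq (suc k)) (sym ([lo+1]+k≡lo+[1+k] lo k))))

range1≡I⁺ : ∀ m → range1 m ≡ I⁺ m
range1≡I⁺ m = trans (map-applyUpTo (λ k → + suc k) (λ k → k) m) (applyUpTo-interval _ (+ 1) m (λ _ → refl))

∑-I⁺-shift≤∑-I± : ∀ {m p} → p ∈ I⁺ m → (φ : ℤ → ℕ) → ∑[ t ∈ I⁺ m ] φ (t ℤ.- p) ≤ ∑ (I± m) φ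
∑-I⁺-shift≤∑-I± {m} p∈ φ with ∈-interval⁻ (+ 1) m p∈
... | k , k<m , refl with ℕP.m≤n⇒∃[o]m+o≡n k<m
... | j , refl = begin
  ∑[ t ∈ I⁺ m ] φ (t ℤ.- + suc k)          ≡⟨ sym (∑-interval-shift (ℤ.- + suc k) (+ 1) m φ) ⟩
  ∑ (interval (+ 1 ℤ.- + suc k) m) φ       ≡⟨ cong (λ lo → ∑ (interval lo m) φ) lower-end ⟩
  ∑ (interval (ℤ.- + m ℤ.+ + suc j) m) φ   ≤⟨ ∑-interval-suffix (ℤ.- + m) (suc j) m φ ⟩
  ∑ (interval (ℤ.- + m) (suc j + m)) φ     ≤⟨ ∑-interval-mono (ℤ.- + m) φ
                                                (s≤s (ℕP.+-monoˡ-≤ m (ℕP.m≤n⇒m≤1+n (ℕP.m≤n+m j k)))) ⟩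
  ∑ (I± m) φ                               ∎
  where
  open ℕP.≤-Reasoning
  identity : ∀ a b → + 1 ℤ.- (+ 1 ℤ.+ a) ≡ ℤ.- (+ 1 ℤ.+ (a ℤ.+ b)) ℤ.+ (+ 1 ℤ.+ b)
  identity = ℤSolver.solve-∀
  lower-end : + 1 ℤ.- + suc k ≡ ℤ.- + m ℤ.+ + suc j
  lower-end = trans (identity (+ k) (+ j)) (cong (λ z → ℤ.- (+ 1 ℤ.+ z) ℤ.+ + suc j) (sym (ℤP.pos-+ k j)))

_∈³_ : Pt → List ℤ → Set
(a , b , c) ∈³ xs = a ∈ xs × b ∈ xs × c ∈ xs

∑³ : List ℤ → (Pt → ℕ) → ℕ
∑³ xs f = ∑[ a ∈ xs ] ∑[ b ∈ xs ] ∑[ c ∈ xs ] f (a , b , c)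

module _ (xs : List ℤ) where

  ∑³-mono : {f g : Pt → ℕ} → (∀ {v} → v ∈³ xs → f v ≤ g v) → ∑³ xs f ≤ ∑³ xs g
  ∑³-mono le = ∑-mono xs λ a∈ → ∑-mono xs λ b∈ → ∑-mono xs λ c∈ → le (a∈ , b∈ , c∈)

  ∑³-cong : {f g : Pt → ℕ} → (∀ v → f v ≡ g v) → ∑³ xs f ≡ ∑³ xs g
  ∑³-cong eq = ∑-cong xs λ a → ∑-cong xs λ b → ∑-cong xs λ c → eq (a , b , c)

  ∑³-monoᵖ : {f g : Pt → ℕ} → (∀ v → f v ≤ g v) → ∑³ xs f ≤ ∑³ xs g
  ∑³-monoᵖ le = ∑³-mono (λ {v} _ → le v)

  ∑³-*ˡ : ∀ k (f : Pt → ℕ) → ∑³ xs (λ v → k * f v) ≡ k * ∑³ xs f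
  ∑³-*ˡ k f = trans (∑-cong xs λ a → trans (∑-cong xs λ b → ∑-*ˡ xs k (λ c → f (a , b , c)))
                                          (∑-*ˡ xs k _))
                    (∑-*ˡ xs k _)

  ∑³-+ : ∀ (f g : Pt → ℕ) → ∑³ xs (λ v → f v + g v) ≡ ∑³ xs f + ∑³ xs g
  ∑³-+ f g = trans (∑-cong xs λ a → trans (∑-cong xs λ b → ∑-+ xs (λ c → f (a , b , c)) (λ c → g (a , b , c)))
                                         (∑-+ xs _ _))
                   (∑-+ xs _ _)

  ∑³-const : ∀ k → ∑³ xs (λ _ → k) ≡ length xs * (length xs * (length xs * k))
  ∑³-const k = trans (∑-cong xs λ _ → trans (∑-cong xs λ _ → ∑-const xs k) (∑-const xs _)) (∑-const xs _)

∑-E : ∀ m (f : Pt → ℕ) → ∑ (E m) f ≡ ∑³ (I⁺ m) f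
∑-E m f rewrite range1≡I⁺ m =
  trans (∑-concatMap _ (I⁺ m) f) (∑-cong (I⁺ m) λ a →
  trans (∑-concatMap _ (I⁺ m) f) (∑-cong (I⁺ m) λ b → ∑-map _ (I⁺ m) f))

∑-E-mono : ∀ m {f g : Pt → ℕ} → (∀ {v} → v ∈³ I⁺ m → f v ≤ g v) → ∑ (E m) f ≤ ∑ (E m) g
∑-E-mono m {f} {g} le = subst₂ _≤_ (sym (∑-E m f)) (sym (∑-E m g)) (∑³-mono (I⁺ m) le)

∑-E-shift≤∑³-I± : ∀ m {p} → p ∈³ I⁺ m → (φ : Pt → ℕ) → ∑[ x ∈ E m ] φ (x -ᵖ p) ≤ ∑³ (I± m) φ
∑-E-shift≤∑³-I± m {p₁ , p₂ , p₃} (p₁∈ , p₂∈ , p₃∈) φ = begin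
  ∑[ x ∈ E m ] φ (x -ᵖ (p₁ , p₂ , p₃))
    ≡⟨ ∑-E m _ ⟩
  ∑[ a ∈ I⁺ m ] ∑[ b ∈ I⁺ m ] ∑[ c ∈ I⁺ m ] φ (a ℤ.- p₁ , b ℤ.- p₂ , c ℤ.- p₃)
    ≤⟨ ∑-monoᵖ (I⁺ m) (λ a → ∑-monoᵖ (I⁺ m) (λ b → ∑-I⁺-shift≤∑-I± p₃∈ _)) ⟩
  ∑[ a ∈ I⁺ m ] ∑[ b ∈ I⁺ m ] ∑[ c ∈ I± m ] φ (a ℤ.- p₁ , b ℤ.- p₂ , c)
    ≤⟨ ∑-monoᵖ (I⁺ m) (λ a → ∑-I⁺-shift≤∑-I± p₂∈ _) ⟩
  ∑[ a ∈ I⁺ m ] ∑[ b ∈ I± m ] ∑[ c ∈ I± m ] φ (a ℤ.- p₁ , b , c)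
    ≤⟨ ∑-I⁺-shift≤∑-I± p₁∈ _ ⟩
  ∑³ (I± m) φ ∎
  where open ℕP.≤-Reasoning

-- Reduction to vectors orthogonal to x₃ − x₂

0ᵖ : Pt
0ᵖ = (+ 0 , + 0 , + 0)

-ᵖ≡0ᵖ⇒≡ : ∀ x y → x -ᵖ y ≡ 0ᵖ → x ≡ y
-ᵖ≡0ᵖ⇒≡ (a , b , c) (p , q , r) eq =
  cong₂ _,_ (ℤP.i-j≡0⇒i≡j a p (cong proj₁ eq))
    (cong₂ _,_ (ℤP.i-j≡0⇒i≡j b q (cong (proj₁ ∘ proj₂) eq)) (ℤP.i-j≡0⇒i≡j c r (cong (proj₂ ∘ proj₂) eq)))

orth : ℕ → Pt → ℕ
orth m v = ∑³ (I± m) (λ a → 𝟙 (dot a v ℤP.≟ + 0))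

orthPairs : ℕ → Pt → ℕ
orthPairs m v = 𝟙 (¬? (v ≟ᵖ 0ᵖ)) * (orth m v * orth m v)

dot-[x₄-x₃]-[x₃-x₂] : ∀ x₂ x₃ x₄ → dot (x₄ -ᵖ x₃) (x₃ -ᵖ x₂) ≡ ℤ.- dot (x₂ -ᵖ x₃) (x₄ -ᵖ x₃)
dot-[x₄-x₃]-[x₃-x₂] (a , b , c) (d , e , f) (g , h , i) = identity a b c d e f g h i
  where
  identity : ∀ a b c d e f g h i →
    (g ℤ.- d) ℤ.* (d ℤ.- a) ℤ.+ (h ℤ.- e) ℤ.* (e ℤ.- b) ℤ.+ (i ℤ.- f) ℤ.* (f ℤ.- c)
    ≡ ℤ.- ((a ℤ.- d) ℤ.* (g ℤ.- d) ℤ.+ (b ℤ.- e) ℤ.* (h ℤ.- e) ℤ.+ (c ℤ.- f) ℤ.* (i ℤ.- f))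
  identity = ℤSolver.solve-∀

𝟙-good≤ : ∀ x₁ x₂ x₃ x₄ → let v = x₃ -ᵖ x₂ in
  𝟙 (good? (x₁ , x₂ , x₃ , x₄))
  ≤ 𝟙 (¬? (v ≟ᵖ 0ᵖ)) * (𝟙 (dot (x₁ -ᵖ x₂) v ℤP.≟ + 0) * 𝟙 (dot (x₄ -ᵖ x₃) v ℤP.≟ + 0))
𝟙-good≤ x₁ x₂ x₃ x₄ with good? (x₁ , x₂ , x₃ , x₄)
... | no _ = z≤n
... | yes ((_ , x₃≢x₂ , ⊥₁) , (_ , _ , ⊥₂))
  rewrite 𝟙-yes (¬? ((x₃ -ᵖ x₂) ≟ᵖ 0ᵖ)) (λ v≡0 → x₃≢x₂ (-ᵖ≡0ᵖ⇒≡ x₃ x₂ v≡0))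
        | 𝟙-yes (dot (x₁ -ᵖ x₂) (x₃ -ᵖ x₂) ℤP.≟ + 0) ⊥₁
        | 𝟙-yes (dot (x₄ -ᵖ x₃) (x₃ -ᵖ x₂) ℤP.≟ + 0) (trans (dot-[x₄-x₃]-[x₃-x₂] x₂ x₃ x₄) (cong ℤ.-_ ⊥₂))
  = s≤s z≤n

∑∑-good≤orthPairs : ∀ m {x₂ x₃} → x₂ ∈³ I⁺ m → x₃ ∈³ I⁺ m →
  ∑[ x₁ ∈ E m ] ∑[ x₄ ∈ E m ] 𝟙 (good? (x₁ , x₂ , x₃ , x₄)) ≤ orthPairs m (x₃ -ᵖ x₂)
∑∑-good≤orthPairs m {x₂} {x₃} x₂∈ x₃∈ = begin
  ∑[ x₁ ∈ E m ] ∑[ x₄ ∈ E m ] 𝟙 (good? (x₁ , x₂ , x₃ , x₄))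
    ≤⟨ ∑-monoᵖ (E m) (λ x₁ → ∑-monoᵖ (E m) (𝟙-good≤ x₁ x₂ x₃)) ⟩
  ∑[ x₁ ∈ E m ] ∑[ x₄ ∈ E m ] (v≠0 * (⊥v x₁ x₂ * ⊥v x₄ x₃))
    ≡⟨ trans (∑-cong (E m) λ x₁ → ∑-*ˡ (E m) v≠0 _) (∑-*ˡ (E m) v≠0 _) ⟩
  v≠0 * (∑[ x₁ ∈ E m ] ∑[ x₄ ∈ E m ] (⊥v x₁ x₂ * ⊥v x₄ x₃))
    ≡⟨ cong (v≠0 *_) (sym (∑-*-∑ (E m) (E m) _ _)) ⟩
  v≠0 * ((∑[ x₁ ∈ E m ] ⊥v x₁ x₂) * (∑[ x₄ ∈ E m ] ⊥v x₄ x₃))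
    ≤⟨ ℕP.*-monoʳ-≤ v≠0 (ℕP.*-mono-≤ (∑-E-shift≤∑³-I± m x₂∈ ⊥v₀) (∑-E-shift≤∑³-I± m x₃∈ ⊥v₀)) ⟩
  orthPairs m v ∎
  where
  open ℕP.≤-Reasoning
  v = x₃ -ᵖ x₂
  v≠0 = 𝟙 (¬? (v ≟ᵖ 0ᵖ))
  ⊥v₀ : Pt → ℕ
  ⊥v₀ a = 𝟙 (dot a v ℤP.≟ + 0)
  ⊥v : Pt → Pt → ℕ
  ⊥v x o = ⊥v₀ (x -ᵖ o)

count≤∑³-orthPairs : ∀ m → count m ≤ m * (m * (m * ∑³ (I± m) (orthPairs m)))
count≤∑³-orthPairs m = begin
  count m
    ≡⟨ count≡ ⟩
  ∑[ x₁ ∈ E m ] ∑[ x₂ ∈ E m ] ∑[ x₃ ∈ E m ] ∑[ x₄ ∈ E m ] 𝟙 (good? (x₁ , x₂ , x₃ , x₄))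
    ≡⟨ trans (∑-comm (E m) (E m) _) (∑-cong (E m) λ x₂ → ∑-comm (E m) (E m) _) ⟩
  ∑[ x₂ ∈ E m ] ∑[ x₃ ∈ E m ] ∑[ x₁ ∈ E m ] ∑[ x₄ ∈ E m ] 𝟙 (good? (x₁ , x₂ , x₃ , x₄))
    ≤⟨ ∑-E-mono m (λ x₂∈ → ∑-E-mono m (λ x₃∈ → ∑∑-good≤orthPairs m x₂∈ x₃∈)) ⟩
  ∑[ x₂ ∈ E m ] ∑[ x₃ ∈ E m ] orthPairs m (x₃ -ᵖ x₂)
    ≤⟨ ∑-E-mono m (λ x₂∈ → ∑-E-shift≤∑³-I± m x₂∈ (orthPairs m)) ⟩
  ∑[ _ ∈ E m ] S
    ≡⟨ trans (∑-E m _) (trans (∑³-const (I⁺ m) S) (cong (λ n → n * (n * (n * S))) (length-interval (+ 1) m))) ⟩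
  m * (m * (m * S)) ∎
  where
  open ℕP.≤-Reasoning
  S = ∑³ (I± m) (orthPairs m)
  Em = E m
  count≡ : count m ≡ ∑[ x₁ ∈ Em ] ∑[ x₂ ∈ Em ] ∑[ x₃ ∈ Em ] ∑[ x₄ ∈ Em ] 𝟙 (good? (x₁ , x₂ , x₃ , x₄))
  count≡ = trans (length-filter good? (E⁴ m))
    (trans (∑-concatMap _ Em _) (∑-cong Em λ x₁ →
     trans (∑-concatMap _ Em _) (∑-cong Em λ x₂ →
     trans (∑-concatMap _ Em _) (∑-cong Em λ x₃ → ∑-map _ Em _))))

-- Solutions of a · v = 0 and divisibility

divCount : ℕ → ℤ → ℤ → ℕ
divCount n c h = ∑[ d ∈ interval (+ 0) n ] 𝟙 (h ∣? c ℤ.* d)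

∑-linear-solutions≤1 : ∀ c h r x lo n → h ≢ + 0 →
  ∑[ y ∈ interval lo n ] 𝟙 (x ℤ.* c ℤ.+ y ℤ.* h ℤP.≟ r) ≤ 𝟙 (h ∣? r ℤ.- x ℤ.* c)
∑-linear-solutions≤1 c h r x lo n h≢0 with h ∣? r ℤ.- x ℤ.* c
... | yes _ = ∑-interval-atMostOne (λ y → x ℤ.* c ℤ.+ y ℤ.* h ℤP.≟ r) unique lo n
  where
  instance _ = ℤ.≢-nonZero h≢0
  unique : ∀ {y y′} → x ℤ.* c ℤ.+ y ℤ.* h ≡ r → x ℤ.* c ℤ.+ y′ ℤ.* h ≡ r → y ≡ y′
  unique {y} {y′} eq eq′ = ℤP.*-cancelʳ-≡ y y′ h (+-cancelˡ-≡ᶻ (x ℤ.* c) _ _ (trans eq (sym eq′)))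
... | no h∤ = ℕP.≤-reflexive (∑-zero (interval lo n) _ λ {y} _ →
                𝟙-no (x ℤ.* c ℤ.+ y ℤ.* h ℤP.≟ r) (λ eq → h∤ (divides y (sym (solved {y} eq)))))
  where
  cancel : ∀ a b → a ℤ.+ b ℤ.- a ≡ b
  cancel = ℤSolver.solve-∀
  solved : ∀ {y} → x ℤ.* c ℤ.+ y ℤ.* h ≡ r → y ℤ.* h ≡ r ℤ.- x ℤ.* c
  solved {y} eq = trans (sym (cancel (x ℤ.* c) (y ℤ.* h))) (cong (ℤ._- x ℤ.* c) eq)

-- Once one x₀ is a solution, x = x₀ + d is a solution exactly when h ∣ c d.
∑-∣-linear≤divCount : ∀ c h r n lo → ∑[ x ∈ interval lo n ] 𝟙 (h ∣? r ℤ.- x ℤ.* c) ≤ divCount n c h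
∑-∣-linear≤divCount c h r zero    lo = z≤n
∑-∣-linear≤divCount c h r (suc n) lo with h ∣? r ℤ.- lo ℤ.* c
... | no _ = ℕP.≤-trans (∑-∣-linear≤divCount c h r n (lo ℤ.+ + 1)) (∑-interval-mono (+ 0) _ (ℕP.n≤1+n n))
... | yes h∣r-lo*c = ℕP.≤-reflexive (begin
  1 + ∑ (interval (lo ℤ.+ + 1) n) F              ≡⟨ cong (_+ ∑ (interval (lo ℤ.+ + 1) n) F) (sym (𝟙-yes (h ∣? _) h∣r-lo*c)) ⟩
  ∑ (interval lo (suc n)) F                     ≡⟨ cong (λ z → ∑ (interval z (suc n)) F) (sym (ℤP.+-identityˡ lo)) ⟩
  ∑ (interval (+ 0 ℤ.+ lo) (suc n)) F           ≡⟨ ∑-interval-shift lo (+ 0) (suc n) F ⟩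
  ∑[ d ∈ interval (+ 0) (suc n) ] F (d ℤ.+ lo)  ≡⟨ ∑-cong (interval (+ 0) (suc n)) same-condition ⟩
  divCount (suc n) c h                          ∎)
  where
  open ≡-Reasoning
  F = λ x → 𝟙 (h ∣? r ℤ.- x ℤ.* c)
  shift : ∀ d → r ℤ.- (d ℤ.+ lo) ℤ.* c ≡ (r ℤ.- lo ℤ.* c) ℤ.- c ℤ.* d
  shift d = identity r d lo c
    where
    identity : ∀ r d lo c → r ℤ.- (d ℤ.+ lo) ℤ.* c ≡ (r ℤ.- lo ℤ.* c) ℤ.- c ℤ.* d
    identity = ℤSolver.solve-∀
  a-[a-b]≡b : ∀ a b → a ℤ.- (a ℤ.- b) ≡ b
  a-[a-b]≡b = ℤSolver.solve-∀
  same-condition : ∀ d → F (d ℤ.+ lo) ≡ 𝟙 (h ∣? c ℤ.* d)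
  same-condition d = 𝟙-cong (h ∣? _) (h ∣? c ℤ.* d)
    (λ h∣ → subst (h ∣_) (a-[a-b]≡b (r ℤ.- lo ℤ.* c) (c ℤ.* d)) (ℤ∣.∣m∣n⇒∣m-n h∣r-lo*c (subst (h ∣_) (shift d) h∣)))
    (λ h∣ → subst (h ∣_) (sym (shift d)) (ℤ∣.∣m∣n⇒∣m-n h∣r-lo*c h∣))

width : ℕ → ℕ
width m = suc (m + m)

∑∑∑-linear≤ : ∀ m c h (r : ℤ → ℤ) → h ≢ + 0 →
  ∑[ z ∈ I± m ] ∑[ x ∈ I± m ] ∑[ y ∈ I± m ] 𝟙 (x ℤ.* c ℤ.+ y ℤ.* h ℤP.≟ r z) ≤ width m * divCount (width m) c h
∑∑∑-linear≤ m c h r h≢0 = ℕP.≤-trans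
  (∑-monoᵖ (I± m) λ z → ℕP.≤-trans (∑-monoᵖ (I± m) λ x → ∑-linear-solutions≤1 c h (r z) x -m (width m) h≢0)
                                   (∑-∣-linear≤divCount c h (r z) (width m) -m))
  (ℕP.≤-reflexive (∑-interval-const -m (width m) (divCount (width m) c h)))
  where -m = ℤ.- + m

𝟙-≟0≡𝟙-≟ : ∀ {s} u w → s ≡ u ℤ.- w → 𝟙 (s ℤP.≟ + 0) ≡ 𝟙 (u ℤP.≟ w)
𝟙-≟0≡𝟙-≟ {s} u w eq = 𝟙-cong (s ℤP.≟ + 0) (u ℤP.≟ w) (λ s≡0 → ℤP.i-j≡0⇒i≡j u w (trans (sym eq) s≡0))
                                                     (λ u≡w → trans eq (ℤP.i≡j⇒i-j≡0 u≡w))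

module _ (m : ℕ) (v₁ v₂ v₃ : ℤ) (v₃≢0 : v₃ ≢ + 0) where
  orth≤divCount₁₃ : orth m (v₁ , v₂ , v₃) ≤ width m * divCount (width m) v₁ v₃
  orth≤divCount₁₃ = ℕP.≤-trans (ℕP.≤-reflexive (trans (∑-comm (I± m) (I± m) _)
      (∑-cong (I± m) λ a₂ → ∑-cong (I± m) λ a₁ → ∑-cong (I± m) λ a₃ →
         𝟙-≟0≡𝟙-≟ _ _ (rearrange (a₁ ℤ.* v₁) (a₂ ℤ.* v₂) (a₃ ℤ.* v₃)))))
    (∑∑∑-linear≤ m v₁ v₃ (λ a₂ → ℤ.- (a₂ ℤ.* v₂)) v₃≢0)
    where
    rearrange : ∀ a b c → a ℤ.+ b ℤ.+ c ≡ (a ℤ.+ c) ℤ.- ℤ.- b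
    rearrange = ℤSolver.solve-∀

  orth≤divCount₂₃ : orth m (v₁ , v₂ , v₃) ≤ width m * divCount (width m) v₂ v₃
  orth≤divCount₂₃ = ℕP.≤-trans (ℕP.≤-reflexive
      (∑-cong (I± m) λ a₁ → ∑-cong (I± m) λ a₂ → ∑-cong (I± m) λ a₃ →
         𝟙-≟0≡𝟙-≟ _ _ (rearrange (a₁ ℤ.* v₁) (a₂ ℤ.* v₂) (a₃ ℤ.* v₃))))
    (∑∑∑-linear≤ m v₂ v₃ (λ a₁ → ℤ.- (a₁ ℤ.* v₁)) v₃≢0)
    where
    rearrange : ∀ a b c → a ℤ.+ b ℤ.+ c ≡ (b ℤ.+ c) ℤ.- ℤ.- a
    rearrange = ℤSolver.solve-∀

rot : Pt → Pt
rot (a , b , c) = (b , c , a)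

∑³-rot : ∀ xs (f : Pt → ℕ) → ∑³ xs (f ∘ rot) ≡ ∑³ xs f
∑³-rot xs f = trans (∑-comm xs xs _) (∑-cong xs λ b → ∑-comm xs xs _)

dot-rot : ∀ a v → dot (rot a) (rot v) ≡ dot a v
dot-rot (a₁ , a₂ , a₃) (v₁ , v₂ , v₃) = identity a₁ a₂ a₃ v₁ v₂ v₃
  where
  identity : ∀ a₁ a₂ a₃ v₁ v₂ v₃ →
    a₂ ℤ.* v₂ ℤ.+ a₃ ℤ.* v₃ ℤ.+ a₁ ℤ.* v₁ ≡ a₁ ℤ.* v₁ ℤ.+ a₂ ℤ.* v₂ ℤ.+ a₃ ℤ.* v₃
  identity = ℤSolver.solve-∀

orth-rot : ∀ m v → orth m (rot v) ≡ orth m v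
orth-rot m v = trans (sym (∑³-rot (I± m) (λ a → 𝟙 (dot a (rot v) ℤP.≟ + 0))))
                     (∑³-cong (I± m) λ a → cong (λ z → 𝟙 (z ℤP.≟ + 0)) (dot-rot a v))

orthPairs-rot : ∀ m v → orthPairs m (rot v) ≡ orthPairs m v
orthPairs-rot m v = cong₂ _*_
  (𝟙-cong (¬? (rot v ≟ᵖ 0ᵖ)) (¬? (v ≟ᵖ 0ᵖ)) (λ rv≢0 v≡0 → rv≢0 (cong rot v≡0))
                                             (λ v≢0 rv≡0 → v≢0 (cong (rot ∘ rot) rv≡0)))
  (cong₂ _*_ (orth-rot m v) (orth-rot m v))

divCountIn : ℕ → ℤ → ℤ → ℕ
divCountIn m c h = 𝟙 (ℤ.∣ c ∣ ℕP.≤? ℤ.∣ h ∣) * divCount (width m) c h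

divPairs : ℕ → Pt → ℕ
divPairs m (v₁ , v₂ , v₃) = 𝟙 (¬? (v₃ ℤP.≟ + 0)) * (divCountIn m v₁ v₃ * divCountIn m v₂ v₃)

largest-≢0 : ∀ {v₁ v₂ v₃} → (v₁ , v₂ , v₃) ≢ 0ᵖ →
             ℤ.∣ v₁ ∣ ≤ ℤ.∣ v₃ ∣ → ℤ.∣ v₂ ∣ ≤ ℤ.∣ v₃ ∣ → v₃ ≢ + 0
largest-≢0 v≢0 ∣v₁∣≤ ∣v₂∣≤ refl =
  v≢0 (cong₂ _,_ (ℤP.∣i∣≡0⇒i≡0 (ℕP.n≤0⇒n≡0 ∣v₁∣≤))
                 (cong₂ _,_ (ℤP.∣i∣≡0⇒i≡0 (ℕP.n≤0⇒n≡0 ∣v₂∣≤)) refl))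

orthPairs≤divPairs : ∀ m v₁ v₂ v₃ → ℤ.∣ v₁ ∣ ≤ ℤ.∣ v₃ ∣ → ℤ.∣ v₂ ∣ ≤ ℤ.∣ v₃ ∣ →
              orthPairs m (v₁ , v₂ , v₃) ≤ width m * width m * divPairs m (v₁ , v₂ , v₃)
orthPairs≤divPairs m v₁ v₂ v₃ ∣v₁∣≤ ∣v₂∣≤ with (v₁ , v₂ , v₃) ≟ᵖ 0ᵖ
... | yes _  = z≤n
... | no v≢0
  rewrite 𝟙-yes (¬? (v₃ ℤP.≟ + 0)) (largest-≢0 v≢0 ∣v₁∣≤ ∣v₂∣≤)
        | 𝟙-yes (ℤ.∣ v₁ ∣ ℕP.≤? ℤ.∣ v₃ ∣) ∣v₁∣≤
        | 𝟙-yes (ℤ.∣ v₂ ∣ ℕP.≤? ℤ.∣ v₃ ∣) ∣v₂∣≤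
  = ℕP.≤-trans (ℕP.≤-reflexive (ℕP.+-identityʳ _))
      (ℕP.≤-trans (ℕP.*-mono-≤ (orth≤divCount₁₃ m v₁ v₂ v₃ v₃≢0) (orth≤divCount₂₃ m v₁ v₂ v₃ v₃≢0))
                  (ℕP.≤-reflexive (regroup (width m) (divCount (width m) v₁ v₃) (divCount (width m) v₂ v₃))))
  where
  v₃≢0 = largest-≢0 v≢0 ∣v₁∣≤ ∣v₂∣≤
  regroup : ∀ k x y → (k * x) * (k * y) ≡ k * k * (1 * ((1 * x) * (1 * y)))
  regroup = solve-∀

largest-coordinate : ∀ a b c → (a ≤ c × b ≤ c) ⊎ (b ≤ a × c ≤ a) ⊎ (c ≤ b × a ≤ b)
largest-coordinate a b c with ℕP.≤-total a c | ℕP.≤-total b c | ℕP.≤-total a b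
... | inj₁ a≤c | inj₁ b≤c | _        = inj₁ (a≤c , b≤c)
... | inj₂ c≤a | _        | inj₂ b≤a = inj₂ (inj₁ (b≤a , c≤a))
... | inj₂ c≤a | _        | inj₁ a≤b = inj₂ (inj₂ (ℕP.≤-trans c≤a a≤b , a≤b))
... | inj₁ a≤c | inj₂ c≤b | _        = inj₂ (inj₂ (c≤b , ℕP.≤-trans a≤c c≤b))

-- Rotating the coordinates does not change orthPairs, and some rotation brings
-- the coordinate of largest absolute value to the third position.
orthPairs≤divPairs-rotations : ∀ m v →
  orthPairs m v ≤ width m * width m * (divPairs m v + (divPairs m (rot v) + divPairs m (rot (rot v))))
orthPairs≤divPairs-rotations m v@(v₁ , v₂ , v₃) with largest-coordinate ℤ.∣ v₁ ∣ ℤ.∣ v₂ ∣ ℤ.∣ v₃ ∣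
... | inj₁ (≤₁ , ≤₂) = ℕP.≤-trans (orthPairs≤divPairs m v₁ v₂ v₃ ≤₁ ≤₂) (ℕP.*-monoʳ-≤ K (ℕP.m≤m+n _ _))
  where K = width m * width m
... | inj₂ (inj₁ (≤₁ , ≤₂)) = begin
  orthPairs m v                ≡⟨ sym (orthPairs-rot m v) ⟩
  orthPairs m (rot v)          ≤⟨ orthPairs≤divPairs m v₂ v₃ v₁ ≤₁ ≤₂ ⟩
  K * divPairs m (rot v)       ≤⟨ ℕP.*-monoʳ-≤ K (ℕP.≤-trans (ℕP.m≤m+n _ _) (ℕP.m≤n+m _ (divPairs m v))) ⟩
  K * (divPairs m v + (divPairs m (rot v) + divPairs m (rot (rot v)))) ∎
  where
  open ℕP.≤-Reasoning
  K = width m * width m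
... | inj₂ (inj₂ (≤₁ , ≤₂)) = begin
  orthPairs m v                ≡⟨ sym (trans (orthPairs-rot m (rot v)) (orthPairs-rot m v)) ⟩
  orthPairs m (rot (rot v))    ≤⟨ orthPairs≤divPairs m v₃ v₁ v₂ ≤₁ ≤₂ ⟩
  K * divPairs m (rot (rot v)) ≤⟨ ℕP.*-monoʳ-≤ K (ℕP.≤-trans (ℕP.m≤n+m _ (divPairs m (rot v)))
                                                             (ℕP.m≤n+m _ (divPairs m v))) ⟩
  K * (divPairs m v + (divPairs m (rot v) + divPairs m (rot (rot v)))) ∎
  where
  open ℕP.≤-Reasoning
  K = width m * width m

Q : ℕ → ℤ → ℕ
Q m h = ∑[ c ∈ I± m ] divCountIn m c h

ΣQ² : ℕ → ℕ
ΣQ² m = ∑[ h ∈ I± m ] 𝟙 (¬? (h ℤP.≟ + 0)) * (Q m h * Q m h)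

∑³-divPairs : ∀ m → ∑³ (I± m) (divPairs m) ≡ ΣQ² m
∑³-divPairs m = trans (∑³-rot (I± m) (F ∘ rot)) (trans (∑³-rot (I± m) F) (∑-cong (I± m) λ h →
  trans (trans (∑-cong (I± m) λ c → ∑-*ˡ (I± m) (h≢0 h) _) (∑-*ˡ (I± m) (h≢0 h) _))
        (cong (h≢0 h *_) (sym (∑-*-∑ (I± m) (I± m) (λ c → divCountIn m c h) (λ c → divCountIn m c h))))))
  where
  h≢0 : ℤ → ℕ
  h≢0 h = 𝟙 (¬? (h ℤP.≟ + 0))
  F : Pt → ℕ
  F (h , c , c′) = h≢0 h * (divCountIn m c h * divCountIn m c′ h)

∑³-orthPairs≤ : ∀ m → ∑³ (I± m) (orthPairs m) ≤ width m * width m * (ΣQ² m + (ΣQ² m + ΣQ² m))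
∑³-orthPairs≤ m = begin
  ∑³ (I± m) (orthPairs m)
    ≤⟨ ∑³-monoᵖ (I± m) (orthPairs≤divPairs-rotations m) ⟩
  ∑³ (I± m) (λ v → K * (divPairs m v + (divPairs m (rot v) + divPairs m (rot (rot v)))))
    ≡⟨ ∑³-*ˡ (I± m) K _ ⟩
  K * ∑³ (I± m) (λ v → divPairs m v + (divPairs m (rot v) + divPairs m (rot (rot v))))
    ≡⟨ cong (K *_) (trans (∑³-+ (I± m) (divPairs m) _) (cong (_+_ T)
         (trans (∑³-+ (I± m) (divPairs m ∘ rot) (divPairs m ∘ rot ∘ rot))
                (cong₂ _+_ (∑³-rot (I± m) (divPairs m))
                           (trans (∑³-rot (I± m) (divPairs m ∘ rot)) (∑³-rot (I± m) (divPairs m))))))) ⟩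
  K * (T + (T + T))
    ≡⟨ cong (λ t → K * (t + (t + t))) (∑³-divPairs m) ⟩
  K * (ΣQ² m + (ΣQ² m + ΣQ² m)) ∎
  where
  open ℕP.≤-Reasoning
  K = width m * width m
  T = ∑³ (I± m) (divPairs m)

-- Divisor sums

∣-[n+k]+k∣≡n : ∀ n k → ℤ.∣ ℤ.- + (n + k) ℤ.+ + k ∣ ≡ n
∣-[n+k]+k∣≡n n k = trans (cong (λ z → ℤ.∣ ℤ.- z ℤ.+ + k ∣) (ℤP.pos-+ n k))
                         (trans (cong ℤ.∣_∣ (identity (+ n) (+ k))) (ℤP.∣-i∣≡∣i∣ (+ n)))
  where
  identity : ∀ a b → ℤ.- (a ℤ.+ b) ℤ.+ b ≡ ℤ.- a
  identity = ℤSolver.solve-∀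

∈-I±⇒∣∣≤ : ∀ m {h} → h ∈ I± m → ℤ.∣ h ∣ ≤ m
∈-I±⇒∣∣≤ m h∈ with ∈-interval⁻ (ℤ.- + m) (width m) h∈
... | k , k<width , refl with ℕP.≤-total k m
... | inj₁ k≤m with ℕP.m≤n⇒∃[o]m+o≡n k≤m
...   | t , refl = ℕP.≤-trans (ℕP.≤-reflexive (trans (cong (λ z → ℤ.∣ ℤ.- + z ℤ.+ + k ∣) (ℕP.+-comm k t))
                                                    (∣-[n+k]+k∣≡n t k))) (ℕP.m≤n+m t k)
∈-I±⇒∣∣≤ m h∈ | k , k<width , refl | inj₂ m≤k with ℕP.m≤n⇒∃[o]m+o≡n m≤k
...   | s , refl = ℕP.≤-trans (ℕP.≤-reflexive (cong ℤ.∣_∣ (identity (+ m) (+ s))))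
                              (ℕP.+-cancelˡ-≤ m s m (ℕP.≤-pred k<width))
  where
  identity : ∀ a b → ℤ.- a ℤ.+ (a ℤ.+ b) ≡ b
  identity = ℤSolver.solve-∀

-- I± (H + j) is I± H with j points on either side, all of absolute value > H.
∑-I±-restrict : ∀ H m → H ≤ m → (F : ℤ → ℕ) → ∑[ c ∈ I± m ] 𝟙 (ℤ.∣ c ∣ ℕP.≤? H) * F c ≤ ∑ (I± H) F
∑-I±-restrict H m H≤m F with ℕP.m≤n⇒∃[o]m+o≡n H≤m
... | j , refl = begin
  ∑ (I± (H + j)) G
    ≡⟨ cong (λ n → ∑ (interval lo n) G) (lengths H j) ⟩
  ∑ (interval lo (j + (width H + j))) G
    ≡⟨ cong (λ xs → ∑ xs G) (trans (interval-++ lo j _) (cong (interval lo j ++_) (trans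
         (cong (λ z → interval z (width H + j)) (-[H+j]+j≡-H H j)) (interval-++ (ℤ.- + H) (width H) j)))) ⟩
  ∑ (interval lo j ++ (I± H ++ interval hi j)) G
    ≡⟨ trans (∑-++ (interval lo j) _ G) (cong (_+_ (∑ (interval lo j) G)) (∑-++ (I± H) _ G)) ⟩
  ∑ (interval lo j) G + (∑ (I± H) G + ∑ (interval hi j) G)
    ≡⟨ cong₂ (λ a b → a + (∑ (I± H) G + b)) (∑-zero _ G (λ {c} c∈ → G-outside {c} (below c∈)))
                                             (∑-zero _ G (λ {c} c∈ → G-outside {c} (above c∈))) ⟩
  ∑ (I± H) G + 0
    ≤⟨ ℕP.≤-trans (ℕP.≤-reflexive (ℕP.+-identityʳ _))
                  (∑-monoᵖ (I± H) λ c → ℕP.≤-trans (ℕP.*-monoˡ-≤ (F c) (𝟙≤1 (ℤ.∣ c ∣ ℕP.≤? H)))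
                                                   (ℕP.≤-reflexive (ℕP.+-identityʳ (F c)))) ⟩
  ∑ (I± H) F ∎
  where
  open ℕP.≤-Reasoning
  lo = ℤ.- + (H + j)
  hi = ℤ.- + H ℤ.+ + width H
  G = λ c → 𝟙 (ℤ.∣ c ∣ ℕP.≤? H) * F c
  lengths : ∀ H j → suc ((H + j) + (H + j)) ≡ j + (suc (H + H) + j)
  lengths = solve-∀
  -[H+j]+j≡-H : ∀ H j → ℤ.- + (H + j) ℤ.+ + j ≡ ℤ.- + H
  -[H+j]+j≡-H H j = trans (cong (λ z → ℤ.- z ℤ.+ + j) (ℤP.pos-+ H j)) (identity (+ H) (+ j))
    where
    identity : ∀ a b → ℤ.- (a ℤ.+ b) ℤ.+ b ≡ ℤ.- a
    identity = ℤSolver.solve-∀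
  G-outside : ∀ {c} → H < ℤ.∣ c ∣ → G c ≡ 0
  G-outside {c} H<∣c∣ = cong (_* F c) (𝟙-no (ℤ.∣ c ∣ ℕP.≤? H) (ℕP.<⇒≱ H<∣c∣))
  below : ∀ {c} → c ∈ interval lo j → H < ℤ.∣ c ∣
  below c∈ with ∈-interval⁻ lo j c∈
  ... | k , k<j , refl with ℕP.m≤n⇒∃[o]m+o≡n k<j
  ... | t , refl = ℕP.≤-trans (ℕP.m≤m+n (suc H) t) (ℕP.≤-reflexive (sym
                     (trans (cong (λ n → ℤ.∣ ℤ.- + n ℤ.+ + k ∣) (shuffle H k t)) (∣-[n+k]+k∣≡n (suc H + t) k))))
    where
    shuffle : ∀ H k t → H + (suc k + t) ≡ (suc H + t) + k
    shuffle = solve-∀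
  above : ∀ {c} → c ∈ interval hi j → H < ℤ.∣ c ∣
  above c∈ with ∈-interval⁻ hi j c∈
  ... | k , _ , refl = ℕP.≤-trans (s≤s (ℕP.m≤m+n H k)) (ℕP.≤-reflexive (sym (cong ℤ.∣_∣ (hi+k≡ H k))))
    where
    identity : ∀ a b → ℤ.- a ℤ.+ (+ 1 ℤ.+ (a ℤ.+ a)) ℤ.+ b ≡ + 1 ℤ.+ (a ℤ.+ b)
    identity = ℤSolver.solve-∀
    hi+k≡ : ∀ H k → ℤ.- + H ℤ.+ + width H ℤ.+ + k ≡ + suc (H + k)
    hi+k≡ H k = trans (cong (λ z → ℤ.- + H ℤ.+ (+ 1 ℤ.+ z) ℤ.+ + k) (ℤP.pos-+ H H))
                      (trans (identity (+ H) (+ k)) (cong (ℤ._+_ (+ 1)) (sym (ℤP.pos-+ H k))))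

splits : ℕ → ℤ → ℤ → ℕ
splits H e f = 𝟙 (e ℤ.* f ℤP.≟ + H)

𝟙-∣*≤∑∑splits : ∀ m h c d → 1 ≤ ℤ.∣ h ∣ → ℤ.∣ h ∣ ≤ m →
  𝟙 (h ∣? c ℤ.* d) ≤ ∑[ e ∈ I⁺ m ] ∑[ f ∈ I⁺ m ] splits ℤ.∣ h ∣ e f * (𝟙 (e ∣? c) * 𝟙 (f ∣? d))
𝟙-∣*≤∑∑splits m h c d 1≤H H≤m with h ∣? c ℤ.* d
... | no _ = z≤n
... | yes h∣cd with ∣*⇒∣-split 1≤H (subst (ℤ.∣ h ∣ ℕ∣.∣_) (ℤP.abs-* c d) (∣⇒∣ᵤ h∣cd))
... | zero , f , ef≡H , _ , _ = ⊥-elim (ℕP.<⇒≱ 1≤H (ℕP.≤-reflexive (sym ef≡H)))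
... | suc e₀ , zero , ef≡H , _ , _ = ⊥-elim (ℕP.<⇒≱ 1≤H (ℕP.≤-reflexive (trans (sym ef≡H) (ℕP.*-zeroʳ (suc e₀)))))
... | e@(suc e₀) , f@(suc f₀) , ef≡H , e∣c , f∣d = ℕP.≤-trans (ℕP.≤-reflexive (sym term≡1))
  (ℕP.≤-trans (∑-≥-term (I⁺ m) _ (∈-interval⁺ (+ 1) (≤m (ℕP.m≤n*m f e))))
              (∑-≥-term (I⁺ m) (λ e → ∑[ f ∈ I⁺ m ] splits ℤ.∣ h ∣ e f * (𝟙 (e ∣? c) * 𝟙 (f ∣? d)))
                        (∈-interval⁺ (+ 1) (≤m (ℕP.m≤m*n e f)))))
  where
  ≤m : ∀ {x} → x ≤ e * f → x ≤ m
  ≤m x≤ef = ℕP.≤-trans x≤ef (ℕP.≤-trans (ℕP.≤-reflexive ef≡H) H≤m)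
  term≡1 : splits ℤ.∣ h ∣ (+ e) (+ f) * (𝟙 (+ e ∣? c) * 𝟙 (+ f ∣? d)) ≡ 1
  term≡1 rewrite 𝟙-yes (+ e ℤ.* + f ℤP.≟ + ℤ.∣ h ∣) (trans (sym (ℤP.pos-* e f)) (cong +_ ef≡H))
               | 𝟙-yes (+ e ∣? c) (∣ᵤ⇒∣ {+ e} {c} e∣c)
               | 𝟙-yes (+ f ∣? d) (∣ᵤ⇒∣ {+ f} {d} f∣d) = refl

divCount≤∑∑splits : ∀ m h c → 1 ≤ ℤ.∣ h ∣ → ℤ.∣ h ∣ ≤ m →
  divCount (width m) c h ≤ ∑[ e ∈ I⁺ m ] ∑[ f ∈ I⁺ m ] splits ℤ.∣ h ∣ e f * (𝟙 (e ∣? c) * multiples f (+ 0) (width m))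
divCount≤∑∑splits m h c 1≤H H≤m = ℕP.≤-trans (∑-monoᵖ D λ d → 𝟙-∣*≤∑∑splits m h c d 1≤H H≤m)
  (ℕP.≤-reflexive (trans (∑-comm D (I⁺ m) _) (∑-cong (I⁺ m) λ e → trans (∑-comm D (I⁺ m) _) (∑-cong (I⁺ m) λ f →
    trans (∑-*ˡ D (splits ℤ.∣ h ∣ e f) _) (cong (splits ℤ.∣ h ∣ e f *_) (∑-*ˡ D (𝟙 (e ∣? c)) _))))))
  where
  D = interval (+ 0) (width m)

∑-splits≤𝟙-∣ : ∀ m h {e} → e ∈ I⁺ m → ∑[ f ∈ I⁺ m ] splits ℤ.∣ h ∣ e f ≤ 𝟙 (e ∣? h)
∑-splits≤𝟙-∣ m h e∈ with ∈-interval⁻ (+ 1) m e∈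
... | e₀ , _ , refl with + suc e₀ ∣? h
... | yes _ = ∑-interval-atMostOne (λ f → + suc e₀ ℤ.* f ℤP.≟ + ℤ.∣ h ∣)
                (λ {f} {f′} ef≡H ef′≡H → ℤP.*-cancelˡ-≡ (+ suc e₀) f f′ (trans ef≡H (sym ef′≡H))) (+ 1) m
... | no e∤h = ℕP.≤-reflexive (∑-zero (I⁺ m) _ λ {f} _ → 𝟙-no (+ suc e₀ ℤ.* f ℤP.≟ + ℤ.∣ h ∣)
                 (λ ef≡H → e∤h (ℤ∣.∣-trans (divides f (trans (sym ef≡H) (ℤP.*-comm (+ suc e₀) f))) ℤ∣.∣m∣∣m)))

width+≤4* : ∀ {x y} → y ≤ x → 1 ≤ x → width x + y ≤ 4 * x
width+≤4* {x} {y} y≤x 1≤x = ℕP.≤-trans (ℕP.+-monoʳ-≤ (width x) y≤x)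
  (ℕP.≤-trans (ℕP.≤-reflexive (shape₁ x)) (ℕP.≤-trans (ℕP.+-monoʳ-≤ (x + x + x) 1≤x) (ℕP.≤-reflexive (shape₂ x))))
  where
  shape₁ : ∀ x → suc (x + x) + x ≡ (x + x + x) + 1
  shape₁ = solve-∀
  shape₂ : ∀ x → (x + x + x) + x ≡ 4 * x
  shape₂ = solve-∀

-- With H = e f: e X ≤ 4 H and f Y ≤ 4 m by counting multiples, so H X Y ≤ 16 H m.
splits*multiples≤ : ∀ m H {e f} → 1 ≤ H → H ≤ m → e ∈ I⁺ m → f ∈ I⁺ m →
  splits H e f * ((∑[ c ∈ I± m ] 𝟙 (ℤ.∣ c ∣ ℕP.≤? H) * 𝟙 (e ∣? c)) * multiples f (+ 0) (width m))
  ≤ 16 * m * splits H e f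
splits*multiples≤ m H {e} {f} 1≤H H≤m e∈ f∈ with e ℤ.* f ℤP.≟ + H
... | no _ = z≤n
... | yes ef≡H with ∈-interval⁻ (+ 1) m e∈ | ∈-interval⁻ (+ 1) m f∈
... | e₀ , _ , refl | f₀ , _ , refl with trans (cong ℤ.∣_∣ (sym (ℤP.pos-* (suc e₀) (suc f₀)))) (cong ℤ.∣_∣ ef≡H)
... | refl = ℕP.≤-trans (ℕP.≤-reflexive (ℕP.+-identityʳ _))
                        (ℕP.≤-trans XY≤16m (ℕP.≤-reflexive (sym (ℕP.*-identityʳ _))))
  where
  open ℕP.≤-Reasoning
  e′ = suc e₀
  f′ = suc f₀
  X = ∑[ c ∈ I± m ] 𝟙 (ℤ.∣ c ∣ ℕP.≤? e′ * f′) * 𝟙 (+ e′ ∣? c)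
  Y = multiples (+ f′) (+ 0) (width m)
  e′≤H : e′ ≤ e′ * f′
  e′≤H = ℕP.m≤m*n e′ f′
  f′≤m : f′ ≤ m
  f′≤m = ℕP.≤-trans (ℕP.m≤n*m f′ e′) H≤m
  e′X≤4H : e′ * X ≤ 4 * (e′ * f′)
  e′X≤4H = begin
    e′ * X                                  ≤⟨ ℕP.*-monoʳ-≤ e′ (∑-I±-restrict (e′ * f′) m H≤m (λ c → 𝟙 (+ e′ ∣? c))) ⟩
    e′ * multiples (+ e′) (ℤ.- + (e′ * f′)) (width (e′ * f′)) ≤⟨ *-multiples≤ e′ (ℤ.- + (e′ * f′)) _ ⟩
    width (e′ * f′) + e′                    ≤⟨ width+≤4* e′≤H (ℕP.≤-trans (s≤s z≤n) e′≤H) ⟩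
    4 * (e′ * f′)                           ∎
  f′Y≤4m : f′ * Y ≤ 4 * m
  f′Y≤4m = ℕP.≤-trans (*-multiples≤ f′ (+ 0) (width m)) (width+≤4* f′≤m (ℕP.≤-trans (s≤s z≤n) f′≤m))
  XY≤16m : X * Y ≤ 16 * m
  XY≤16m = ℕP.*-cancelˡ-≤ (e′ * f′) (begin
    e′ * f′ * (X * Y)             ≡⟨ interchange e′ f′ X Y ⟩
    (e′ * X) * (f′ * Y)           ≤⟨ ℕP.*-mono-≤ e′X≤4H f′Y≤4m ⟩
    (4 * (e′ * f′)) * (4 * m)     ≡⟨ collect (e′ * f′) m ⟩
    e′ * f′ * (16 * m)            ∎)
    where
    interchange : ∀ a b x y → a * b * (x * y) ≡ (a * x) * (b * y)
    interchange = solve-∀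
    collect : ∀ a b → (4 * a) * (4 * b) ≡ a * (16 * b)
    collect = solve-∀

τ : ℕ → ℤ → ℕ
τ m h = ∑[ e ∈ I⁺ m ] 𝟙 (e ∣? h)

Q≤16m*τ : ∀ m {h} → h ∈ I± m → h ≢ + 0 → Q m h ≤ 16 * m * τ m h
Q≤16m*τ m {h} h∈ h≢0 = begin
  Q m h
    ≤⟨ ∑-monoᵖ (I± m) (λ c → ℕP.*-monoʳ-≤ (I c) (divCount≤∑∑splits m h c 1≤H H≤m)) ⟩
  ∑[ c ∈ I± m ] I c * (∑[ e ∈ I⁺ m ] ∑[ f ∈ I⁺ m ] T e f c)
    ≡⟨ ∑-cong (I± m) (λ c → trans (sym (∑-*ˡ (I⁺ m) (I c) _))
                                  (∑-cong (I⁺ m) λ e → sym (∑-*ˡ (I⁺ m) (I c) (λ f → T e f c)))) ⟩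
  ∑[ c ∈ I± m ] ∑[ e ∈ I⁺ m ] ∑[ f ∈ I⁺ m ] I c * T e f c
    ≡⟨ trans (∑-comm (I± m) (I⁺ m) _) (∑-cong (I⁺ m) λ e → ∑-comm (I± m) (I⁺ m) _) ⟩
  ∑[ e ∈ I⁺ m ] ∑[ f ∈ I⁺ m ] ∑[ c ∈ I± m ] I c * T e f c
    ≡⟨ ∑-cong (I⁺ m) (λ e → ∑-cong (I⁺ m) λ f → factor e f) ⟩
  ∑[ e ∈ I⁺ m ] ∑[ f ∈ I⁺ m ] splits H e f * (X e * Y f)
    ≤⟨ ∑-mono (I⁺ m) (λ e∈ → ∑-mono (I⁺ m) λ f∈ → splits*multiples≤ m H 1≤H H≤m e∈ f∈) ⟩
  ∑[ e ∈ I⁺ m ] ∑[ f ∈ I⁺ m ] 16 * m * splits H e f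
    ≡⟨ ∑-cong (I⁺ m) (λ e → ∑-*ˡ (I⁺ m) (16 * m) (splits H e)) ⟩
  ∑[ e ∈ I⁺ m ] 16 * m * (∑[ f ∈ I⁺ m ] splits H e f)
    ≤⟨ ∑-mono (I⁺ m) (λ e∈ → ℕP.*-monoʳ-≤ (16 * m) (∑-splits≤𝟙-∣ m h e∈)) ⟩
  ∑[ e ∈ I⁺ m ] 16 * m * 𝟙 (e ∣? h)
    ≡⟨ ∑-*ˡ (I⁺ m) (16 * m) _ ⟩
  16 * m * τ m h ∎
  where
  open ℕP.≤-Reasoning
  H = ℤ.∣ h ∣
  1≤H : 1 ≤ H
  1≤H = ℕP.n≢0⇒n>0 (λ H≡0 → h≢0 (ℤP.∣i∣≡0⇒i≡0 H≡0))
  H≤m : H ≤ m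
  H≤m = ∈-I±⇒∣∣≤ m h∈
  I : ℤ → ℕ
  I c = 𝟙 (ℤ.∣ c ∣ ℕP.≤? H)
  X : ℤ → ℕ
  X e = ∑[ c ∈ I± m ] I c * 𝟙 (e ∣? c)
  Y : ℤ → ℕ
  Y f = multiples f (+ 0) (width m)
  T : ℤ → ℤ → ℤ → ℕ
  T e f c = splits H e f * (𝟙 (e ∣? c) * Y f)
  factor : ∀ e f → ∑[ c ∈ I± m ] I c * T e f c ≡ splits H e f * (X e * Y f)
  factor e f = trans (∑-cong (I± m) λ c → shuffle (I c) (splits H e f) (𝟙 (e ∣? c)) (Y f))
              (trans (∑-*ˡ (I± m) (splits H e f) _) (cong (splits H e f *_) (∑-*ʳ (I± m) (Y f) (λ c → I c * 𝟙 (e ∣? c)))))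
    where
    shuffle : ∀ i s a y → i * (s * (a * y)) ≡ s * ((i * a) * y)
    shuffle = solve-∀

∑-𝟙-≤≤ : ∀ a n e → ∑[ f ∈ interval (+ a) n ] 𝟙 (f ℤP.≤? + e) ≤ suc e ℕ.∸ a
∑-𝟙-≤≤ a zero    e = z≤n
∑-𝟙-≤≤ a (suc n) e rewrite cong (λ z → interval z n) (cong +_ (ℕP.+-comm a 1)) with + a ℤP.≤? + e
... | yes a≤e = ℕP.≤-trans (ℕP.+-monoʳ-≤ 1 (∑-𝟙-≤≤ (suc a) n e))
                           (ℕP.≤-reflexive (sym (ℕP.+-∸-assoc 1 (ℤP.drop‿+≤+ a≤e))))
... | no _    = ℕP.≤-trans (∑-𝟙-≤≤ (suc a) n e) (ℕP.∸-monoˡ-≤ a (ℕP.n≤1+n e))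

μ : ℕ → ℤ → ℕ
μ m e = multiples e (ℤ.- + m) (width m)

∑-common-multiples≤ : ∀ m e f →
  ∑[ h ∈ I± m ] 𝟙 (e ∣? h) * 𝟙 (f ∣? h) ≤ 𝟙 (f ℤP.≤? e) * μ m e + 𝟙 (e ℤP.≤? f) * μ m f
∑-common-multiples≤ m e f with ℤP.≤-total f e
... | inj₁ f≤e rewrite 𝟙-yes (f ℤP.≤? e) f≤e = ℕP.≤-trans
  (∑-monoᵖ (I± m) λ h → ℕP.≤-trans (ℕP.*-monoʳ-≤ (𝟙 (e ∣? h)) (𝟙≤1 (f ∣? h)))
                                   (ℕP.≤-reflexive (ℕP.*-identityʳ _)))
  (ℕP.≤-trans (ℕP.≤-reflexive (sym (ℕP.+-identityʳ (μ m e)))) (ℕP.m≤m+n _ _))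
... | inj₂ e≤f rewrite 𝟙-yes (e ℤP.≤? f) e≤f = ℕP.≤-trans
  (∑-monoᵖ (I± m) λ h → ℕP.≤-trans (ℕP.*-monoˡ-≤ (𝟙 (f ∣? h)) (𝟙≤1 (e ∣? h)))
                                   (ℕP.≤-reflexive (ℕP.+-identityʳ _)))
  (ℕP.≤-trans (ℕP.≤-reflexive (sym (ℕP.+-identityʳ (μ m f)))) (ℕP.m≤n+m _ (𝟙 (f ℤP.≤? e) * μ m e)))

∑∑-[f≤e]*μ≤ : ∀ m → 1 ≤ m → ∑[ e ∈ I⁺ m ] ∑[ f ∈ I⁺ m ] 𝟙 (f ℤP.≤? e) * μ m e ≤ m * (4 * m)
∑∑-[f≤e]*μ≤ m 1≤m = ℕP.≤-trans (∑-mono (I⁺ m) bound) (ℕP.≤-reflexive (∑-interval-const (+ 1) m (4 * m)))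
  where
  bound : ∀ {e} → e ∈ I⁺ m → ∑[ f ∈ I⁺ m ] 𝟙 (f ℤP.≤? e) * μ m e ≤ 4 * m
  bound e∈ with ∈-interval⁻ (+ 1) m e∈
  ... | e₀ , e₀<m , refl = begin
    ∑[ f ∈ I⁺ m ] 𝟙 (f ℤP.≤? + suc e₀) * μ m (+ suc e₀)
      ≡⟨ ∑-*ʳ (I⁺ m) (μ m (+ suc e₀)) _ ⟩
    (∑[ f ∈ I⁺ m ] 𝟙 (f ℤP.≤? + suc e₀)) * μ m (+ suc e₀)
      ≤⟨ ℕP.*-monoˡ-≤ (μ m (+ suc e₀)) (∑-𝟙-≤≤ 1 m (suc e₀)) ⟩
    suc e₀ * μ m (+ suc e₀)
      ≤⟨ *-multiples≤ (suc e₀) (ℤ.- + m) (width m) ⟩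
    width m + suc e₀
      ≤⟨ width+≤4* e₀<m 1≤m ⟩
    4 * m ∎
    where open ℕP.≤-Reasoning

-- Σ_h τ(h)² counts pairs of divisors e, f of a common h; bound it by the
-- multiples of max(e, f), of which there are about 2m / max(e, f).
∑-τ²≤ : ∀ m → 1 ≤ m → ∑[ h ∈ I± m ] τ m h * τ m h ≤ m * (4 * m) + m * (4 * m)
∑-τ²≤ m 1≤m = begin
  ∑[ h ∈ I± m ] τ m h * τ m h
    ≡⟨ ∑-cong (I± m) (λ h → ∑-*-∑ (I⁺ m) (I⁺ m) (λ e → 𝟙 (e ∣? h)) (λ f → 𝟙 (f ∣? h))) ⟩
  ∑[ h ∈ I± m ] ∑[ e ∈ I⁺ m ] ∑[ f ∈ I⁺ m ] P e f h
    ≡⟨ trans (∑-comm (I± m) (I⁺ m) _) (∑-cong (I⁺ m) λ e → ∑-comm (I± m) (I⁺ m) _) ⟩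
  ∑[ e ∈ I⁺ m ] ∑[ f ∈ I⁺ m ] ∑[ h ∈ I± m ] P e f h
    ≤⟨ ∑-monoᵖ (I⁺ m) (λ e → ∑-monoᵖ (I⁺ m) λ f → ∑-common-multiples≤ m e f) ⟩
  ∑[ e ∈ I⁺ m ] ∑[ f ∈ I⁺ m ] (A e f + A f e)
    ≡⟨ trans (∑-cong (I⁺ m) λ e → ∑-+ (I⁺ m) (A e) (λ f → A f e)) (∑-+ (I⁺ m) _ _) ⟩
  (∑[ e ∈ I⁺ m ] ∑[ f ∈ I⁺ m ] A e f) + (∑[ e ∈ I⁺ m ] ∑[ f ∈ I⁺ m ] A f e)
    ≡⟨ cong (_+_ (∑[ e ∈ I⁺ m ] ∑[ f ∈ I⁺ m ] A e f)) (∑-comm (I⁺ m) (I⁺ m) λ e f → A f e) ⟩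
  (∑[ e ∈ I⁺ m ] ∑[ f ∈ I⁺ m ] A e f) + (∑[ f ∈ I⁺ m ] ∑[ e ∈ I⁺ m ] A f e)
    ≤⟨ ℕP.+-mono-≤ (∑∑-[f≤e]*μ≤ m 1≤m) (∑∑-[f≤e]*μ≤ m 1≤m) ⟩
  m * (4 * m) + m * (4 * m) ∎
  where
  open ℕP.≤-Reasoning
  P : ℤ → ℤ → ℤ → ℕ
  P e f h = 𝟙 (e ∣? h) * 𝟙 (f ∣? h)
  A : ℤ → ℤ → ℕ
  A e f = 𝟙 (f ℤP.≤? e) * μ m e

ΣQ²≤ : ∀ m → 1 ≤ m → ΣQ² m ≤ (16 * m * (16 * m)) * (m * (4 * m) + m * (4 * m))
ΣQ²≤ m 1≤m = ℕP.≤-trans (∑-mono (I± m) bound)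
  (ℕP.≤-trans (ℕP.≤-reflexive (∑-*ˡ (I± m) (16 * m * (16 * m)) (λ h → τ m h * τ m h)))
              (ℕP.*-monoʳ-≤ (16 * m * (16 * m)) (∑-τ²≤ m 1≤m)))
  where
  bound : ∀ {h} → h ∈ I± m → 𝟙 (¬? (h ℤP.≟ + 0)) * (Q m h * Q m h) ≤ (16 * m * (16 * m)) * (τ m h * τ m h)
  bound {h} h∈ with h ℤP.≟ + 0
  ... | yes _  = z≤n
  ... | no h≢0 = ℕP.≤-trans (ℕP.≤-reflexive (ℕP.+-identityʳ _))
      (ℕP.≤-trans (ℕP.*-mono-≤ (Q≤16m*τ m h∈ h≢0) (Q≤16m*τ m h∈ h≢0)) (ℕP.≤-reflexive (interchange (16 * m) (τ m h))))
    where
    interchange : ∀ a b → (a * b) * (a * b) ≡ (a * a) * (b * b)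
    interchange = solve-∀

width≤3* : ∀ {m} → 1 ≤ m → width m ≤ 3 * m
width≤3* {m} 1≤m = ℕP.≤-trans (ℕP.≤-reflexive (shape₁ m))
                              (ℕP.≤-trans (ℕP.+-monoʳ-≤ (m + m) 1≤m) (ℕP.≤-reflexive (shape₂ m)))
  where
  shape₁ : ∀ m → suc (m + m) ≡ (m + m) + 1
  shape₁ = solve-∀
  shape₂ : ∀ m → (m + m) + m ≡ 3 * m
  shape₂ = solve-∀

count≤55296*n³ : ∀ m → 1 ≤ m → count m ≤ 55296 * (m ^ 3) ^ 3
count≤55296*n³ m 1≤m = begin
  count m
    ≤⟨ count≤∑³-orthPairs m ⟩
  m * (m * (m * ∑³ (I± m) (orthPairs m)))
    ≤⟨ ℕP.*-monoʳ-≤ m (ℕP.*-monoʳ-≤ m (ℕP.*-monoʳ-≤ m (∑³-orthPairs≤ m))) ⟩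
  m * (m * (m * (width m * width m * (ΣQ² m + (ΣQ² m + ΣQ² m)))))
    ≤⟨ ℕP.*-monoʳ-≤ m (ℕP.*-monoʳ-≤ m (ℕP.*-monoʳ-≤ m
         (ℕP.*-mono-≤ (ℕP.*-mono-≤ (width≤3* 1≤m) (width≤3* 1≤m)) (ℕP.+-mono-≤ W≤ (ℕP.+-mono-≤ W≤ W≤))))) ⟩
  m * (m * (m * (3 * m * (3 * m) * (B + (B + B)))))
    ≡⟨ collect m ⟩
  55296 * (m ^ 3) ^ 3 ∎
  where
  open ℕP.≤-Reasoning
  B = (16 * m * (16 * m)) * (m * (4 * m) + m * (4 * m))
  W≤ = ΣQ²≤ m 1≤m
  collect : ∀ m →
    m * (m * (m * (3 * m * (3 * m) * ((16 * m * (16 * m)) * (m * (4 * m) + m * (4 * m))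
                                     + ((16 * m * (16 * m)) * (m * (4 * m) + m * (4 * m))
                                     + (16 * m * (16 * m)) * (m * (4 * m) + m * (4 * m)))))))
    ≡ 55296 * ((m * (m * (m * 1))) * ((m * (m * (m * 1))) * ((m * (m * (m * 1))) * 1)))
  collect = solve-∀

corollary4p2 : Σ ℕ λ C → Σ ℕ λ N → (m : ℕ) → 1 ≤ m → N < m ^ 3 →
    count m ≤ C * (m ^ 3) ^ 3
corollary4p2 = 55296 , 0 , λ m 1≤m _ → count≤55296*n³ m 1≤m
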